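{- Assume that $d_n^2 < 2p_n$ for every integer $n\geq 1$ with $n\neq 4$. Then for every integer $n\geq 1$, $$p_{n+2} < p_n + 1 + 2\sqrt2\,\sqrt{p_n} = \left(\sqrt{p_n}+\sqrt2\right)^2 - 1,$$ i.e. there are at least two primes in the interval $\left(p_n, (\sqrt{p_n}+\sqrt 2)^2-1\right)$.
   Context: $p_n$ denotes the $n$th prime ($p_1=2$) and $d_n := p_{n+1}-p_n$. -}

module Defs where

open import Data.Nat using (ℕ; zero; suc; _+_; _*_; _∸_; _!)
open import Data.Nat.Primality using (prime?)
open import Relation.Nullary using (yes; no)

searchPrime : ℕ → ℕ → ℕ
searchPrime k zero = k
searchPrime k (suc fuel) with prime? k
... | yes _ = k
... | no  _ = searchPrime (suc k) fuel

-- nextPrime m : the least prime strictly greater than m.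
-- Fuel m ! suffices: some prime lies in (m, m ! + 1] (Euclid's argument).
nextPrime : ℕ → ℕ
nextPrime m = searchPrime (suc m) (m !)

-- p n : the n-th prime, 1-indexed (p 1 = 2, p 2 = 3, ...).
-- p 0 = 1 is a junk value and is never used in the statement (n ≥ 1 there).
p : ℕ → ℕ
p zero = 1
p (suc n) = nextPrime (p n)

d : ℕ → ℕ
d n = p (suc n) ∸ p n

{-# OPTIONS --safe #-}
-- Write g = d n and b = d (n + 1), so that p (n + 2) − (p n + 1) = g − 1 + b. The hypothesis
-- at n and n + 1 reads g² < 2 p n and b² < 2 (p n + g); doubling and adding the two, and using
-- (x + y)² ≤ 2x² + 2y², gives (g − 1 + b)² + 2 ≤ 8 p n. The hypothesis omits d 4 = 11 − 7 (for which it is false),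
-- so the two cases n = 3, 4 that need it are checked numerically instead.
module Submission where

open import Defs
open import Data.List using ([]; _∷_)
open import Data.Nat using (zero; suc; _+_; _*_; _∸_; _<_; _≤_; _!; z≤n; s≤s; _≟_; _<?_)
open import Data.Nat.Primality using (prime?)
open import Data.Nat.Properties
open import Data.Nat.Tactic.RingSolver using (solve)
open import Data.Product using (_,_)
open import Data.Sum using ([_,_]′)
open import Function using (_∘_)
open import Relation.Binary.PropositionalEquality
  using (_≡_; _≢_; refl; sym; trans; cong; subst; subst₂; module ≡-Reasoning)
open import Relation.Nullary using (yes; no)
open import Relation.Nullary.Decidable using (from-yes)

[m+n]²≤2m²+2n² : ∀ m n → (m + n) * (m + n) ≤ 2 * (m * m) + 2 * (n * n)
[m+n]²≤2m²+2n² m n = [ ordered , swapped ]′ (≤-total m n)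
  where
  ordered : ∀ {x y} → x ≤ y → (x + y) * (x + y) ≤ 2 * (x * x) + 2 * (y * y)
  ordered {x} x≤y with m≤n⇒∃[o]m+o≡n x≤y
  ... | k , refl = ≤-trans (m≤m+n _ (k * k)) (≤-reflexive (solve (x ∷ k ∷ [])))

  swapped : n ≤ m → (m + n) * (m + n) ≤ 2 * (m * m) + 2 * (n * n)
  swapped n≤m = subst₂ _≤_ (cong (λ s → s * s) (+-comm n m)) (+-comm (2 * (n * n)) _) (ordered n≤m)

consecutive-gaps-bound : ∀ q g b → 0 < g → g * g < 2 * q → b * b < 2 * (q + g) →
                         (g + b ∸ 1) * (g + b ∸ 1) < 8 * q
consecutive-gaps-bound q (suc a) b _ g²<2q b²<2[q+g] = <⇒≤ (+-cancelʳ-≤ (4 + 4 * a) _ _ (begin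
  2 + (a + b) * (a + b) + (4 + 4 * a)
    ≤⟨ +-monoˡ-≤ (4 + 4 * a) (+-monoʳ-≤ 2 ([m+n]²≤2m²+2n² a b)) ⟩
  2 + (2 * (a * a) + 2 * (b * b)) + (4 + 4 * a)
    ≡⟨ solve (a ∷ b ∷ []) ⟩
  2 * suc (suc a * suc a) + 2 * suc (b * b)
    ≤⟨ +-mono-≤ (*-monoʳ-≤ 2 g²<2q) (*-monoʳ-≤ 2 b²<2[q+g]) ⟩
  2 * (2 * q) + 2 * (2 * (q + suc a))
    ≡⟨ solve (q ∷ a ∷ []) ⟩
  8 * q + (4 + 4 * a) ∎))
  where open ≤-Reasoning

searchPrime-≥ : ∀ k fuel → k ≤ searchPrime k fuel
searchPrime-≥ k zero = ≤-refl
searchPrime-≥ k (suc fuel) with prime? k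
... | yes _ = ≤-refl
... | no  _ = ≤-trans (n≤1+n k) (searchPrime-≥ (suc k) fuel)

p[n]<p[1+n] : ∀ n → p n < p (suc n)
p[n]<p[1+n] n = searchPrime-≥ (suc (p n)) (p n !)

0<d : ∀ n → 0 < d n
0<d n = m<n⇒0<n∸m (p[n]<p[1+n] n)

p[1+n]≡p[n]+d[n] : ∀ n → p (suc n) ≡ p n + d n
p[1+n]≡p[n]+d[n] n = sym (m+[n∸m]≡n (<⇒≤ (p[n]<p[1+n] n)))

p[n+2]∸[p[n]+1]≡d[n]+d[1+n]∸1 : ∀ n → p (n + 2) ∸ (p n + 1) ≡ d n + d (suc n) ∸ 1
p[n+2]∸[p[n]+1]≡d[n]+d[1+n]∸1 n = begin
  p (n + 2) ∸ (p n + 1)                ≡⟨ cong (λ m → p m ∸ (p n + 1)) (+-comm n 2) ⟩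
  p (2 + n) ∸ (p n + 1)                ≡⟨ cong (_∸ (p n + 1)) p[2+n]≡p[n]+d[n]+d[1+n] ⟩
  p n + d n + d (suc n) ∸ (p n + 1)    ≡⟨ cong (_∸ (p n + 1)) (+-assoc (p n) (d n) (d (suc n))) ⟩
  p n + (d n + d (suc n)) ∸ (p n + 1)  ≡⟨ [m+n]∸[m+o]≡n∸o (p n) (d n + d (suc n)) 1 ⟩
  d n + d (suc n) ∸ 1                  ∎
  where
  open ≡-Reasoning
  p[2+n]≡p[n]+d[n]+d[1+n] : p (2 + n) ≡ p n + d n + d (suc n)
  p[2+n]≡p[n]+d[n]+d[1+n] =
    trans (p[1+n]≡p[n]+d[n] (suc n)) (cong (_+ d (suc n)) (p[1+n]≡p[n]+d[n] n))

two-gaps-bound : ∀ n → d n * d n < 2 * p n → d (suc n) * d (suc n) < 2 * p (suc n) →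
                 (p (n + 2) ∸ (p n + 1)) * (p (n + 2) ∸ (p n + 1)) < 8 * p n
two-gaps-bound n d[n]²<2p[n] d[1+n]²<2p[1+n] =
  subst (λ x → x * x < 8 * p n) (sym (p[n+2]∸[p[n]+1]≡d[n]+d[1+n]∸1 n))
    (consecutive-gaps-bound (p n) (d n) (d (suc n)) (0<d n) d[n]²<2p[n]
      (subst (λ q → d (suc n) * d (suc n) < 2 * q) (p[1+n]≡p[n]+d[n] n) d[1+n]²<2p[1+n]))

theorem2p14 :
    (∀ n → 1 ≤ n → n ≢ 4 → d n * d n < 2 * p n) →
    ∀ n → 1 ≤ n → (p (n + 2) ∸ (p n + 1)) * (p (n + 2) ∸ (p n + 1)) < 8 * p n
theorem2p14 hyp n 1≤n with n ≟ 3 | n ≟ 4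
... | yes refl | _        = from-yes ((p 5 ∸ (p 3 + 1)) * (p 5 ∸ (p 3 + 1)) <? 8 * p 3)
... | _        | yes refl = from-yes ((p 6 ∸ (p 4 + 1)) * (p 6 ∸ (p 4 + 1)) <? 8 * p 4)
... | no n≢3   | no n≢4   =
  two-gaps-bound n (hyp n 1≤n n≢4) (hyp (suc n) (s≤s z≤n) (n≢3 ∘ suc-injective))
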